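{- In the $(r,k)$-quantifier-variable tree game on $(\mathcal{A},\mathcal{B})$, if Duplicator has a winning strategy, then the oblivious strategy is a winning strategy for Duplicator.
   Context: The $(r,k)$-QVT game on sets $\mathcal{A},\mathcal{B}$ of $\tau$-structures uses pebble colors $x_1,\dots,x_k$. Spoiler and Duplicator grow a game tree $\mathcal{T}$ whose nodes are triples $(\text{left},\text{right},r')$ of two sets of pebbled $\tau$-structures (at most one pebble of each color per structure; within a node a color is present on one structure iff on all) and a counter $r'\in\mathbb{N}$. The root $(\mathcal{A},\mathcal{B},r)$ (no pebbles) is an open leaf. Spoiler picks an open leaf $X=(\mathcal{A}',\mathcal{B}',r')$ and: (Pebble-Left, if $r'\ge1$) chooses color $x_i$, removes all pebbles of color $x_i$ if present, places a pebble $x_i$ on an element of each structure of $\mathcal{A}'$; Duplicator, for each structure of $\mathcal{B}'$, may make any number of copies and places a pebble $x_i$ on an element of each copy; new child with counter $r'-1$. (Pebble-Right) dual. (Split-Left) chooses $r'_1+r'_2=r'$ and a partition $\mathcal{A}'=\mathcal{A}'_1\cup\mathcal{A}'_2$, creating children $(\mathcal{A}'_1,\mathcal{B}',r'_1)$, $(\mathcal{A}'_2,\mathcal{B}',r'_2)$. (Split-Right) dual. (Swap) creates child $(\mathcal{B}',\mathcal{A}',r')$. (Close) if some atomic formula $\varphi$ in variables among $x_1,\dots,x_k$, whose variables are pebbled on all structures of $X$, holds (with variables interpreted by the correspondingly colored pebbles) on every structure of $\mathcal{A}'$ and fails on every structure of $\mathcal{B}'$, marks $X$ closed. Spoiler wins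 if all leaves become closed; otherwise Duplicator wins. Duplicator's oblivious strategy: whenever she must respond, for every pebbled structure on her side she makes as many copies as there are elements in its universe and places the pebble on a different element in each copy. -}

module Defs where

open import Level using (Level; 0ℓ) renaming (suc to lsuc)
open import Data.Nat using (ℕ; zero; suc; _+_)
open import Data.Fin using (Fin; _≟_)
open import Data.Bool using (Bool; true; false; not)
open import Data.Maybe using (Maybe; just; nothing)
open import Data.Vec using (Vec; []; _∷_)
open import Data.List using (List; []; _∷_)
open import Data.Product using (Σ; _×_; _,_)
open import Data.Empty using (⊥)
open import Relation.Nullary.Decidable using (⌊_⌋)
open import Relation.Binary.PropositionalEquality using (_≡_)
open import Relation.Unary using (Pred)

record Vocab : Set where
  field
    nRel  : ℕ
    arity : Fin nRel → ℕ
open Vocab public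

-- Finite τ-structures with a NONEMPTY universe, represented as Fin (suc n).

record Structure (τ : Vocab) : Set where
  field
    size-1 : ℕ
    rel    : (R : Fin (nRel τ)) → Vec (Fin (suc size-1)) (arity τ R) → Bool
open Structure public

Elem : ∀ {τ} → Structure τ → Set
Elem 𝔄 = Fin (suc (size-1 𝔄))

module Game (τ : Vocab) (k : ℕ) where

  record PStructure : Set where
    constructor pstr
    field
      str : Structure τ
      peb : Fin k → Maybe (Elem str)
  open PStructure public

  PElem : PStructure → Set
  PElem s = Elem (str s)

  place : (i : Fin k) (s : PStructure) → PElem s → PStructure
  place i (pstr 𝔄 p) e = pstr 𝔄 (λ j → if-eq j)
    where
      if-eq : Fin k → Maybe (Elem 𝔄)
      if-eq j with ⌊ j ≟ i ⌋
      ... | true  = just e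
      ... | false = p j

  unpebbled : Structure τ → PStructure
  unpebbled 𝔄 = pstr 𝔄 (λ _ → nothing)

  data Atom : Set where
    eqA  : Fin k → Fin k → Atom
    relA : (R : Fin (nRel τ)) → Vec (Fin k) (arity τ R) → Atom

  lookupVars : (s : PStructure) {l : ℕ} → Vec (Fin k) l → Maybe (Vec (PElem s) l)
  lookupVars s [] = just []
  lookupVars s (x ∷ xs) with peb s x | lookupVars s xs
  ... | just a  | just as = just (a ∷ as)
  ... | _       | _       = nothing

  eval : Atom → PStructure → Maybe Bool
  eval (eqA x y) s with peb s x | peb s y
  ... | just a | just b = just ⌊ a ≟ b ⌋
  ... | _      | _      = nothing
  eval (relA R xs) s with lookupVars s xs
  ... | just as = just (rel (str s) R as)
  ... | nothing = nothing

  PSet : Set₁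
  PSet = Pred PStructure 0ℓ

  record Node : Set₁ where
    constructor node
    field
      left  : PSet
      right : PSet
      count : ℕ

  SpoilerChoice : Set
  SpoilerChoice = (s : PStructure) → PElem s

  -- Duplicator's response: for each structure on her side, the set of
  -- elements on which (copies of it) get the pebble (any number of copies).
  Response : Set
  Response = (s : PStructure) → PElem s → Bool

  spoilerPlace : PSet → Fin k → SpoilerChoice → PSet
  spoilerPlace 𝒳 i f t = Σ PStructure λ s → 𝒳 s × (t ≡ place i s (f s))

  duplicatorPlace : PSet → Fin k → Response → PSet
  duplicatorPlace 𝒴 i g t =
    Σ PStructure λ s → 𝒴 s × Σ (PElem s) λ e → (g s e ≡ true) × (t ≡ place i s e)

  part₁ part₂ : PSet → (PStructure → Bool) → PSet
  part₁ 𝒳 P s = 𝒳 s × (P s ≡ true)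
  part₂ 𝒳 P s = 𝒳 s × (P s ≡ false)

  data Side : Set where
    pebbleLeft pebbleRight : Side

  -- A Duplicator strategy: given the history (the nodes on the branch from
  -- the root to the current node, most recent first), the current node,
  -- the kind of pebble move, the colour and Spoiler's placement, she
  -- answers with a response.
  Strategy : Set₁
  Strategy = List Node → Node → Side → Fin k → SpoilerChoice → Response

  oblivious : Strategy
  oblivious _ _ _ _ _ _ _ = true

  -- SpoilerWins σ h X : Spoiler, playing against the Duplicator strategy σ,
  -- can (in finitely many moves) close every leaf of the subtree grown from
  -- the open leaf X whose branch-history is h.
  data SpoilerWins (σ : Strategy) : List Node → Node → Set₁ where
    close : ∀ {h 𝒜 ℬ r} (φ : Atom)
          → (∀ s → 𝒜 s → eval φ s ≡ just true)
          → (∀ s → ℬ s → eval φ s ≡ just false)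
          → SpoilerWins σ h (node 𝒜 ℬ r)
    pebL  : ∀ {h 𝒜 ℬ r} (i : Fin k) (f : SpoilerChoice)
          → SpoilerWins σ (node 𝒜 ℬ (suc r) ∷ h)
              (node (spoilerPlace 𝒜 i f)
                    (duplicatorPlace ℬ i (σ h (node 𝒜 ℬ (suc r)) pebbleLeft i f))
                    r)
          → SpoilerWins σ h (node 𝒜 ℬ (suc r))
    pebR  : ∀ {h 𝒜 ℬ r} (i : Fin k) (f : SpoilerChoice)
          → SpoilerWins σ (node 𝒜 ℬ (suc r) ∷ h)
              (node (duplicatorPlace 𝒜 i (σ h (node 𝒜 ℬ (suc r)) pebbleRight i f))
                    (spoilerPlace ℬ i f)
                    r)
          → SpoilerWins σ h (node 𝒜 ℬ (suc r))
    splitL : ∀ {h 𝒜 ℬ r} (r₁ r₂ : ℕ) → r₁ + r₂ ≡ r → (P : PStructure → Bool)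
          → SpoilerWins σ (node 𝒜 ℬ r ∷ h) (node (part₁ 𝒜 P) ℬ r₁)
          → SpoilerWins σ (node 𝒜 ℬ r ∷ h) (node (part₂ 𝒜 P) ℬ r₂)
          → SpoilerWins σ h (node 𝒜 ℬ r)
    splitR : ∀ {h 𝒜 ℬ r} (r₁ r₂ : ℕ) → r₁ + r₂ ≡ r → (P : PStructure → Bool)
          → SpoilerWins σ (node 𝒜 ℬ r ∷ h) (node 𝒜 (part₁ ℬ P) r₁)
          → SpoilerWins σ (node 𝒜 ℬ r ∷ h) (node 𝒜 (part₂ ℬ P) r₂)
          → SpoilerWins σ h (node 𝒜 ℬ r)
    swap  : ∀ {h 𝒜 ℬ r}
          → SpoilerWins σ (node 𝒜 ℬ r ∷ h) (node ℬ 𝒜 r)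
          → SpoilerWins σ h (node 𝒜 ℬ r)

  liftSet : Pred (Structure τ) 0ℓ → PSet
  liftSet 𝒜 t = Σ (Structure τ) λ 𝔄 → 𝒜 𝔄 × (t ≡ unpebbled 𝔄)

  root : Pred (Structure τ) 0ℓ → Pred (Structure τ) 0ℓ → ℕ → Node
  root 𝒜 ℬ r = node (liftSet 𝒜) (liftSet ℬ) r

  DuplicatorWinsWith : Strategy → Pred (Structure τ) 0ℓ → Pred (Structure τ) 0ℓ → ℕ → Set₁
  DuplicatorWinsWith σ 𝒜 ℬ r = SpoilerWins σ [] (root 𝒜 ℬ r) → ⊥

{-# OPTIONS --safe #-}
-- The oblivious response pebbles every element of every copy, so the set it
-- produces contains the set produced by any other response. A Spoiler win is
-- preserved when both sides of a node shrink: closing atoms still separate,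
-- and each of Spoiler's moves can be replayed on the smaller sides. Hence
-- Spoiler's win against the oblivious strategy, replayed move by move,
-- defeats every Duplicator strategy.
module Submission where

open import Defs
open import Level using (0ℓ)
open import Data.Nat using (ℕ)
open import Data.Bool using (true)
open import Data.Product using (Σ; _,_)
open import Relation.Unary using (Pred; _⊆_)
open import Relation.Binary.PropositionalEquality using (refl)

module Monotonicity (τ : Vocab) (k : ℕ) where
  open Game τ k

  spoilerPlace-mono : ∀ {𝒳 𝒴} i f → 𝒳 ⊆ 𝒴 → spoilerPlace 𝒳 i f ⊆ spoilerPlace 𝒴 i f
  spoilerPlace-mono i f 𝒳⊆𝒴 (s , x , eq) = s , 𝒳⊆𝒴 x , eq

  duplicatorPlace-⊆-all : ∀ {𝒳 𝒴} i g → 𝒳 ⊆ 𝒴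
    → duplicatorPlace 𝒳 i g ⊆ duplicatorPlace 𝒴 i (λ _ _ → true)
  duplicatorPlace-⊆-all i g 𝒳⊆𝒴 (s , x , e , _ , eq) = s , 𝒳⊆𝒴 x , e , refl , eq

  part₁-mono : ∀ {𝒳 𝒴} P → 𝒳 ⊆ 𝒴 → part₁ 𝒳 P ⊆ part₁ 𝒴 P
  part₁-mono P 𝒳⊆𝒴 (x , p) = 𝒳⊆𝒴 x , p

  part₂-mono : ∀ {𝒳 𝒴} P → 𝒳 ⊆ 𝒴 → part₂ 𝒳 P ⊆ part₂ 𝒴 P
  part₂-mono P 𝒳⊆𝒴 (x , p) = 𝒳⊆𝒴 x , p

module Transfer (τ : Vocab) (k : ℕ) (σ : Game.Strategy τ k) where
  open Game τ k
  open Monotonicity τ k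

  spoilerWins-oblivious⇒spoilerWins : ∀ {h 𝒜 ℬ r} → SpoilerWins oblivious h (node 𝒜 ℬ r)
    → ∀ {h′ 𝒜′ ℬ′} → 𝒜′ ⊆ 𝒜 → ℬ′ ⊆ ℬ → SpoilerWins σ h′ (node 𝒜′ ℬ′ r)
  spoilerWins-oblivious⇒spoilerWins (close φ true-on-𝒜 false-on-ℬ) 𝒜′⊆𝒜 ℬ′⊆ℬ =
    close φ (λ s a → true-on-𝒜 s (𝒜′⊆𝒜 a)) (λ s b → false-on-ℬ s (ℬ′⊆ℬ b))
  spoilerWins-oblivious⇒spoilerWins (pebL i f w) 𝒜′⊆𝒜 ℬ′⊆ℬ =
    pebL i f (spoilerWins-oblivious⇒spoilerWins w
      (spoilerPlace-mono i f 𝒜′⊆𝒜) (duplicatorPlace-⊆-all i _ ℬ′⊆ℬ))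
  spoilerWins-oblivious⇒spoilerWins (pebR i f w) 𝒜′⊆𝒜 ℬ′⊆ℬ =
    pebR i f (spoilerWins-oblivious⇒spoilerWins w
      (duplicatorPlace-⊆-all i _ 𝒜′⊆𝒜) (spoilerPlace-mono i f ℬ′⊆ℬ))
  spoilerWins-oblivious⇒spoilerWins (splitL r₁ r₂ r₁+r₂≡r P w₁ w₂) {𝒜′ = 𝒜′} 𝒜′⊆𝒜 ℬ′⊆ℬ =
    splitL r₁ r₂ r₁+r₂≡r P
      (spoilerWins-oblivious⇒spoilerWins w₁ (part₁-mono {𝒳 = 𝒜′} P 𝒜′⊆𝒜) ℬ′⊆ℬ)
      (spoilerWins-oblivious⇒spoilerWins w₂ (part₂-mono {𝒳 = 𝒜′} P 𝒜′⊆𝒜) ℬ′⊆ℬ)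
  spoilerWins-oblivious⇒spoilerWins (splitR r₁ r₂ r₁+r₂≡r P w₁ w₂) {ℬ′ = ℬ′} 𝒜′⊆𝒜 ℬ′⊆ℬ =
    splitR r₁ r₂ r₁+r₂≡r P
      (spoilerWins-oblivious⇒spoilerWins w₁ 𝒜′⊆𝒜 (part₁-mono {𝒳 = ℬ′} P ℬ′⊆ℬ))
      (spoilerWins-oblivious⇒spoilerWins w₂ 𝒜′⊆𝒜 (part₂-mono {𝒳 = ℬ′} P ℬ′⊆ℬ))
  spoilerWins-oblivious⇒spoilerWins (swap w) 𝒜′⊆𝒜 ℬ′⊆ℬ =
    swap (spoilerWins-oblivious⇒spoilerWins w ℬ′⊆ℬ 𝒜′⊆𝒜)

proposition5p5 : (τ : Vocab) (k r : ℕ) (𝒜 ℬ : Pred (Structure τ) 0ℓ)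
    → Σ (Game.Strategy τ k) (λ σ → Game.DuplicatorWinsWith τ k σ 𝒜 ℬ r)
    → Game.DuplicatorWinsWith τ k (Game.oblivious τ k) 𝒜 ℬ r
proposition5p5 τ k r 𝒜 ℬ (σ , σ-wins) spoiler-beats-oblivious =
  σ-wins (spoilerWins-oblivious⇒spoilerWins spoiler-beats-oblivious (λ a → a) (λ b → b))
  where open Transfer τ k σ
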